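{- Let $P$ be a nonempty rational polyhedron whose affine hull is $\{x:Ax=b\}$, where $A$ and $b$ are integral. Then for every prime $p$, $P$ contains a $p$-adic point if and only if there does not exist a vector $y$ such that $y^\top A$ is integral and $y^\top b$ is not a $p$-adic rational.
   Context: A $p$-adic rational is a number of the form $a/p^k$ with $a,k$ integers and $k\geq 0$; a vector (point) is $p$-adic if all its entries are $p$-adic rationals. -}

module Defs where

open import Data.Nat using (ℕ; zero; suc; _^_)
open import Data.Integer using (ℤ)
open import Data.Rational using (ℚ; _/_; _+_; _*_; _≤_; 0ℚ; 1ℚ)
open import Data.Fin using (Fin; zero; suc)
open import Data.Product using (Σ; ∃; _×_)
open import Relation.Binary.PropositionalEquality using (_≡_)

ℤ→ℚ : ℤ → ℚ
ℤ→ℚ z = z / 1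

ℕ→ℚ : ℕ → ℚ
ℕ→ℚ n = ℤ→ℚ (Data.Integer.+ n)

Vecℚ : ℕ → Set
Vecℚ n = Fin n → ℚ

Σℚ : {n : ℕ} → (Fin n → ℚ) → ℚ
Σℚ {zero} f = 0ℚ
Σℚ {suc n} f = f zero + Σℚ (λ i → f (suc i))

IsIntegral : ℚ → Set
IsIntegral q = ∃ λ (a : ℤ) → q ≡ ℤ→ℚ a

-- q is a p-adic rational: q = a / p^k with a ∈ ℤ, k ∈ ℕ
-- (written as q * p^k = a to avoid a NonZero side condition)
IsPAdic : ℕ → ℚ → Set
IsPAdic p q = Σ ℤ λ a → Σ ℕ λ k → q * ℕ→ℚ (p ^ k) ≡ ℤ→ℚ a

IsPAdicPoint : ℕ → {n : ℕ} → Vecℚ n → Set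
IsPAdicPoint p x = ∀ j → IsPAdic p (x j)

record Polyhedron (n : ℕ) : Set where
  field
    k : ℕ
    C : Fin k → Fin n → ℚ
    d : Fin k → ℚ

_∈P_ : {n : ℕ} → Vecℚ n → Polyhedron n → Set
x ∈P P = ∀ i → Σℚ (λ j → C i j * x j) ≤ d i
  where open Polyhedron P

Nonempty : {n : ℕ} → Polyhedron n → Set
Nonempty P = ∃ λ x → x ∈P P

InAffineHull : {n : ℕ} → Polyhedron n → Vecℚ n → Set
InAffineHull {n} P x =
  Σ ℕ λ r → Σ (Fin r → Vecℚ n) λ v → Σ (Fin r → ℚ) λ λs →
    (∀ i → v i ∈P P) × (Σℚ λs ≡ 1ℚ) × (∀ j → Σℚ (λ i → λs i * v i j) ≡ x j)

AffineHullIs : {n m : ℕ} → Polyhedron n → (Fin m → Fin n → ℤ) → (Fin m → ℤ) → Set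
AffineHullIs {n} P A b =
  (x : Vecℚ n) →
    (InAffineHull P x → ∀ i → Σℚ (λ j → ℤ→ℚ (A i j) * x j) ≡ ℤ→ℚ (b i)) ×
    ((∀ i → Σℚ (λ j → ℤ→ℚ (A i j) * x j) ≡ ℤ→ℚ (b i)) → InAffineHull P x)

{-# OPTIONS --safe #-}
-- If x ∈ P is p-adic then Ax = b, so for every y with yA integral, yb = (yA)x is a sum of
-- integers times p-adic rationals. Conversely, elimination over the p-adic rationals proves a
-- p-adic Farkas lemma: integral column operations (Euclid's algorithm on the first row) and
-- pivoting on a lone nonzero entry preserve both the dual condition and p-adic solvability, so
-- if there is no certificate y, then Ax₀ = b for some p-adic x₀. This x₀ lies in the affine hull
-- of P, and the centroid c of the points of P spanning x₀ is tight only on constraints on which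
-- x₀ is tight. Hence c + t(x₀ − c) ∈ P for all small t ≥ 0, and choosing t = r/pᵉ so that 1 − t
-- clears the denominators of c − x₀ up to a power of p makes this point p-adic.

module Submission where

open import Defs
open import Data.Nat using (ℕ)
open import Data.Nat.Primality using (Prime)
open import Data.Integer using (ℤ)
open import Data.Rational using (ℚ; _*_)
open import Data.Fin using (Fin)
open import Data.Product using (∃; _×_)
open import Relation.Nullary using (¬_)
open import Function.Bundles using (_⇔_)

open import Data.Nat as ℕ using (zero; suc; _^_; _⊔_; NonZero)
import Data.Nat.Properties as ℕP
open import Data.Nat.Divisibility as ℕD using (_∣_; divides; _∣?_)
open import Data.Nat.Coprimality as ℕC using (Coprime)
open import Data.Nat.DivMod using (_%_; _/_; m≡m%n+[m/n]*n; m%n<n)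
open import Data.Nat.Induction using (<-wellFounded)
open import Data.Nat.Primality using (prime⇒irreducible; prime⇒nonZero; prime⇒nonTrivial)
open import Data.Integer as ℤ using (0ℤ; ∣_∣)
import Data.Integer.Properties as ℤP
open import Data.Integer.DivMod using (a≡a%n+[a/n]*n; n%d<d)
open import Data.Rational as ℚ using (mkℚ; _+_; -_; _-_; 0ℚ; 1ℚ; 1/_; _≤_; _<_; toℚᵘ)
import Data.Rational.Properties as ℚP
open import Data.Rational.Unnormalised as ℚᵘ using (mkℚᵘ; *≡*) renaming (_≃_ to _≃ᵘ_)
import Data.Rational.Unnormalised.Properties as ℚᵘP
open import Data.Rational.Solver using (module +-*-Solver)
open import Data.Fin using (zero; suc)
import Data.Fin.Properties as FinP
open import Data.Vec.Functional using (updateAt; tail; _∷_)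
open import Data.Vec.Functional.Properties using (updateAt-updates; updateAt-minimal)
open import Data.Product using (Σ; _,_; proj₁; proj₂)
open import Data.Sum using (inj₁; inj₂)
open import Data.Empty using (⊥-elim)
open import Function using (_∘_; const)
open import Function.Bundles using (Equivalence; mk⇔)
open import Induction.WellFounded using (Acc; acc)
open import Relation.Nullary using (Dec; yes; no)
open import Relation.Nullary.Decidable using (map′; decidable-stable)
open import Relation.Nullary.Negation using (contradiction)
open import Relation.Binary.PropositionalEquality
open +-*-Solver

toℚᵘ-ℤ→ℚ : ∀ z → toℚᵘ (ℤ→ℚ z) ≃ᵘ mkℚᵘ z 0
toℚᵘ-ℤ→ℚ z = ℚP.toℚᵘ-fromℚᵘ (mkℚᵘ z 0)

≡ℤ→ℚ : ∀ {q z} → toℚᵘ q ≃ᵘ mkℚᵘ z 0 → q ≡ ℤ→ℚ z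
≡ℤ→ℚ {q} {z} eq = ℚP.toℚᵘ-injective (ℚᵘP.≃-trans eq (ℚᵘP.≃-sym (toℚᵘ-ℤ→ℚ z)))

ℤ→ℚ-+ : ∀ a b → ℤ→ℚ (a ℤ.+ b) ≡ ℤ→ℚ a + ℤ→ℚ b
ℤ→ℚ-+ a b = sym (≡ℤ→ℚ (begin
  toℚᵘ (ℤ→ℚ a + ℤ→ℚ b)                    ≈⟨ ℚP.toℚᵘ-homo-+ (ℤ→ℚ a) (ℤ→ℚ b) ⟩
  toℚᵘ (ℤ→ℚ a) ℚᵘ.+ toℚᵘ (ℤ→ℚ b)          ≈⟨ ℚᵘP.+-cong (toℚᵘ-ℤ→ℚ a) (toℚᵘ-ℤ→ℚ b) ⟩
  mkℚᵘ a 0 ℚᵘ.+ mkℚᵘ b 0                   ≈⟨ *≡* (cong (ℤ._* ℤ.+ 1) (cong₂ ℤ._+_ (ℤP.*-identityʳ a) (ℤP.*-identityʳ b))) ⟩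
  mkℚᵘ (a ℤ.+ b) 0                         ∎))
  where open ℚᵘP.≃-Reasoning

ℤ→ℚ-* : ∀ a b → ℤ→ℚ (a ℤ.* b) ≡ ℤ→ℚ a * ℤ→ℚ b
ℤ→ℚ-* a b = sym (≡ℤ→ℚ (begin
  toℚᵘ (ℤ→ℚ a * ℤ→ℚ b)                    ≈⟨ ℚP.toℚᵘ-homo-* (ℤ→ℚ a) (ℤ→ℚ b) ⟩
  toℚᵘ (ℤ→ℚ a) ℚᵘ.* toℚᵘ (ℤ→ℚ b)          ≈⟨ ℚᵘP.*-cong (toℚᵘ-ℤ→ℚ a) (toℚᵘ-ℤ→ℚ b) ⟩
  mkℚᵘ a 0 ℚᵘ.* mkℚᵘ b 0                   ≈⟨ ℚᵘP.≃-refl ⟩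
  mkℚᵘ (a ℤ.* b) 0                         ∎))
  where open ℚᵘP.≃-Reasoning

ℤ→ℚ-neg : ∀ a → ℤ→ℚ (ℤ.- a) ≡ - ℤ→ℚ a
ℤ→ℚ-neg a = sym (≡ℤ→ℚ (ℚᵘP.≃-trans (ℚP.toℚᵘ-homo‿- (ℤ→ℚ a)) (ℚᵘP.-‿cong (toℚᵘ-ℤ→ℚ a))))

ℤ→ℚ-injective : ∀ {a b} → ℤ→ℚ a ≡ ℤ→ℚ b → a ≡ b
ℤ→ℚ-injective {a} {b} eq with ℚᵘP.≃-trans (ℚᵘP.≃-sym (toℚᵘ-ℤ→ℚ a)) (ℚᵘP.≃-trans (ℚP.toℚᵘ-cong eq) (toℚᵘ-ℤ→ℚ b))
... | *≡* a*1≡b*1 = trans (sym (ℤP.*-identityʳ a)) (trans a*1≡b*1 (ℤP.*-identityʳ b))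

ℕ→ℚ-* : ∀ m n → ℕ→ℚ (m ℕ.* n) ≡ ℕ→ℚ m * ℕ→ℚ n
ℕ→ℚ-* m n = trans (cong ℤ→ℚ (ℤP.pos-* m n)) (ℤ→ℚ-* (ℤ.+ m) (ℤ.+ n))

*ℕ→ℚ≡ℤ→ℚ⇔ : ∀ q N a → (q * ℕ→ℚ N ≡ ℤ→ℚ a) ⇔ (ℚ.↥ q ℤ.* ℤ.+ N ≡ a ℤ.* ℚ.↧ q)
*ℕ→ℚ≡ℤ→ℚ⇔ q@(mkℚ _ d _) N a = mk⇔ to from
  where
  toℚᵘ-q*N : toℚᵘ (q * ℕ→ℚ N) ≃ᵘ toℚᵘ q ℚᵘ.* mkℚᵘ (ℤ.+ N) 0
  toℚᵘ-q*N = ℚᵘP.≃-trans (ℚP.toℚᵘ-homo-* q (ℕ→ℚ N)) (ℚᵘP.*-congˡ {toℚᵘ q} (toℚᵘ-ℤ→ℚ (ℤ.+ N)))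
  to : q * ℕ→ℚ N ≡ ℤ→ℚ a → ℚ.↥ q ℤ.* ℤ.+ N ≡ a ℤ.* ℚ.↧ q
  to eq with ℚᵘP.≃-trans (ℚᵘP.≃-sym toℚᵘ-q*N) (ℚᵘP.≃-trans (ℚP.toℚᵘ-cong eq) (toℚᵘ-ℤ→ℚ a))
  ... | *≡* h = trans (sym (ℤP.*-identityʳ _)) (trans h (cong (λ e → a ℤ.* ℤ.+ suc e) (ℕP.*-identityʳ d)))
  from : ℚ.↥ q ℤ.* ℤ.+ N ≡ a ℤ.* ℚ.↧ q → q * ℕ→ℚ N ≡ ℤ→ℚ a
  from h = ≡ℤ→ℚ {z = a} (ℚᵘP.≃-trans toℚᵘ-q*N
    (*≡* (trans (ℤP.*-identityʳ _) (trans h (cong (λ e → a ℤ.* ℤ.+ suc e) (sym (ℕP.*-identityʳ d)))))))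

ℕ→ℚ-+ : ∀ m n → ℕ→ℚ (m ℕ.+ n) ≡ ℕ→ℚ m + ℕ→ℚ n
ℕ→ℚ-+ m n = trans (cong ℤ→ℚ (ℤP.pos-+ m n)) (ℤ→ℚ-+ (ℤ.+ m) (ℤ.+ n))

ℤ→ℚ-mono-≤ : ∀ {a b} → a ℤ.≤ b → ℤ→ℚ a ≤ ℤ→ℚ b
ℤ→ℚ-mono-≤ {a} {b} a≤b = ℚP.toℚᵘ-cancel-≤
  (ℚᵘP.≤-respˡ-≃ (ℚᵘP.≃-sym (toℚᵘ-ℤ→ℚ a)) (ℚᵘP.≤-respʳ-≃ (ℚᵘP.≃-sym (toℚᵘ-ℤ→ℚ b)) (ℚᵘ.*≤* (ℤP.*-monoʳ-≤-nonNeg (ℤ.+ 1) a≤b))))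

ℕ→ℚ-mono-≤ : ∀ {m n} → m ℕ.≤ n → ℕ→ℚ m ≤ ℕ→ℚ n
ℕ→ℚ-mono-≤ m≤n = ℤ→ℚ-mono-≤ (ℤ.+≤+ m≤n)

archimedean : ∀ q → ∃ λ N → q ≤ ℕ→ℚ N
archimedean q@(mkℚ n d _) = ℤ.∣ n ∣ , ℚP.toℚᵘ-cancel-≤ (ℚᵘP.≤-respʳ-≃ (ℚᵘP.≃-sym (toℚᵘ-ℤ→ℚ (ℤ.+ ℤ.∣ n ∣))) (ℚᵘ.*≤* (begin
  n ℤ.* ℤ.+ 1                  ≡⟨ ℤP.*-identityʳ n ⟩
  n                            ≤⟨ i≤∣i∣ n ⟩
  ℤ.+ ℤ.∣ n ∣                  ≤⟨ ℤ.+≤+ (ℕP.m≤m*n ℤ.∣ n ∣ (suc d)) ⟩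
  ℤ.+ (ℤ.∣ n ∣ ℕ.* suc d)      ≡⟨ ℤP.pos-* ℤ.∣ n ∣ (suc d) ⟩
  ℤ.+ ℤ.∣ n ∣ ℤ.* ℤ.+ suc d    ∎)))
  where
  open ℤP.≤-Reasoning
  i≤∣i∣ : ∀ i → i ℤ.≤ ℤ.+ ℤ.∣ i ∣
  i≤∣i∣ (ℤ.+ _)    = ℤP.≤-refl
  i≤∣i∣ ℤ.-[1+ _ ] = ℤ.-≤+

Σℚ-cong : ∀ {n} {f g : Fin n → ℚ} → (∀ i → f i ≡ g i) → Σℚ f ≡ Σℚ g
Σℚ-cong {zero}  f≗g = refl
Σℚ-cong {suc n} f≗g = cong₂ _+_ (f≗g zero) (Σℚ-cong (λ i → f≗g (suc i)))

Σℚ-zero : ∀ n → Σℚ {n} (λ _ → 0ℚ) ≡ 0ℚ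
Σℚ-zero zero    = refl
Σℚ-zero (suc n) = trans (ℚP.+-identityˡ _) (Σℚ-zero n)

Σℚ-+ : ∀ {n} (f g : Fin n → ℚ) → Σℚ (λ i → f i + g i) ≡ Σℚ f + Σℚ g
Σℚ-+ {zero}  f g = refl
Σℚ-+ {suc n} f g = trans (cong ((f zero + g zero) +_) (Σℚ-+ (λ i → f (suc i)) (λ i → g (suc i))))
  (solve 4 (λ a b c d → (a :+ b) :+ (c :+ d) := (a :+ c) :+ (b :+ d)) refl (f zero) (g zero) _ _)

Σℚ-*ˡ : ∀ {n} c (f : Fin n → ℚ) → Σℚ (λ i → c * f i) ≡ c * Σℚ f
Σℚ-*ˡ {zero}  c f = sym (ℚP.*-zeroʳ c)
Σℚ-*ˡ {suc n} c f = trans (cong ((c * f zero) +_) (Σℚ-*ˡ c (λ i → f (suc i)))) (sym (ℚP.*-distribˡ-+ c (f zero) _))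

Σℚ-*ʳ : ∀ {n} (f : Fin n → ℚ) c → Σℚ (λ i → f i * c) ≡ Σℚ f * c
Σℚ-*ʳ f c = trans (Σℚ-cong (λ i → ℚP.*-comm (f i) c)) (trans (Σℚ-*ˡ c f) (ℚP.*-comm c (Σℚ f)))

Σℚ-swap : ∀ {m n} (f : Fin m → Fin n → ℚ) → Σℚ (λ i → Σℚ (f i)) ≡ Σℚ (λ j → Σℚ (λ i → f i j))
Σℚ-swap {zero}  {n} f = sym (Σℚ-zero n)
Σℚ-swap {suc m} f = trans (cong (Σℚ (f zero) +_) (Σℚ-swap (λ i → f (suc i))))
  (sym (Σℚ-+ (f zero) (λ j → Σℚ (λ i → f (suc i) j))))

Σℚ-const : ∀ n w → Σℚ {n} (λ _ → w) ≡ ℕ→ℚ n * w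
Σℚ-const zero    w = sym (ℚP.*-zeroˡ w)
Σℚ-const (suc n) w = begin
  w + Σℚ {n} (λ _ → w)          ≡⟨ cong (w +_) (Σℚ-const n w) ⟩
  w + ℕ→ℚ n * w                 ≡⟨ solve 2 (λ w n → w :+ n :* w := (con 1ℚ :+ n) :* w) refl w (ℕ→ℚ n) ⟩
  (1ℚ + ℕ→ℚ n) * w              ≡⟨ cong (_* w) (ℤ→ℚ-+ (ℤ.+ 1) (ℤ.+ n)) ⟨
  ℕ→ℚ (suc n) * w               ∎
  where open ≡-Reasoning

Σℚ-update : ∀ {n} (f g : Fin n → ℚ) j → (∀ l → l ≢ j → f l ≡ g l) → Σℚ f ≡ Σℚ g + (f j - g j)
Σℚ-update f g zero f≗g = trans (cong (f zero +_) (Σℚ-cong (λ i → f≗g (suc i) λ ())))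
  (solve 3 (λ a b s → a :+ s := (b :+ s) :+ (a :- b)) refl (f zero) (g zero) _)
Σℚ-update f g (suc j) f≗g = trans
  (cong₂ _+_ (f≗g zero λ ()) (Σℚ-update (λ i → f (suc i)) (λ i → g (suc i)) j (λ l l≢j → f≗g (suc l) (l≢j ∘ FinP.suc-injective))))
  (sym (ℚP.+-assoc (g zero) _ _))

Σℚ-mono-≤ : ∀ {n} {f g : Fin n → ℚ} → (∀ i → f i ≤ g i) → Σℚ f ≤ Σℚ g
Σℚ-mono-≤ {zero}  f≤g = ℚP.≤-refl
Σℚ-mono-≤ {suc n} f≤g = ℚP.+-mono-≤ (f≤g zero) (Σℚ-mono-≤ (λ i → f≤g (suc i)))

Σℚ-mono-< : ∀ {n} {f g : Fin n → ℚ} → (∀ i → f i ≤ g i) → ∀ j → f j < g j → Σℚ f < Σℚ g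
Σℚ-mono-< f≤g zero    fj<gj = ℚP.+-mono-<-≤ fj<gj (Σℚ-mono-≤ (λ i → f≤g (suc i)))
Σℚ-mono-< f≤g (suc j) fj<gj = ℚP.+-mono-≤-< (f≤g zero) (Σℚ-mono-< (λ i → f≤g (suc i)) j fj<gj)

Σℚ-≤-≡⇒≡ : ∀ {n} {f g : Fin n → ℚ} → (∀ i → f i ≤ g i) → Σℚ f ≡ Σℚ g → ∀ i → f i ≡ g i
Σℚ-≤-≡⇒≡ {f = f} {g} f≤g Σf≡Σg i with f i ℚP.<? g i
... | no  fi≮gi = ℚP.≤-antisym (f≤g i) (ℚP.≮⇒≥ fi≮gi)
... | yes fi<gi = contradiction Σf≡Σg (ℚP.<⇒≢ (Σℚ-mono-< f≤g i fi<gi))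

infix 8 _·_

_·_ : ∀ {n} → Vecℚ n → Vecℚ n → ℚ
u · v = Σℚ (λ j → u j * v j)

·-comm : ∀ {n} (u v : Vecℚ n) → u · v ≡ v · u
·-comm u v = Σℚ-cong (λ j → ℚP.*-comm (u j) (v j))

·-swap : ∀ {m n} (y : Vecℚ m) (M : Fin m → Vecℚ n) (x : Vecℚ n) →
         y · (λ i → M i · x) ≡ (λ j → y · (λ i → M i j)) · x
·-swap y M x = begin
  Σℚ (λ i → y i * Σℚ (λ j → M i j * x j))         ≡⟨ Σℚ-cong (λ i → Σℚ-*ˡ (y i) (λ j → M i j * x j)) ⟨
  Σℚ (λ i → Σℚ (λ j → y i * (M i j * x j)))       ≡⟨ Σℚ-swap (λ i j → y i * (M i j * x j)) ⟩
  Σℚ (λ j → Σℚ (λ i → y i * (M i j * x j)))       ≡⟨ Σℚ-cong (λ j → Σℚ-cong (λ i → ℚP.*-assoc (y i) (M i j) (x j))) ⟨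
  Σℚ (λ j → Σℚ (λ i → y i * M i j * x j))         ≡⟨ Σℚ-cong (λ j → Σℚ-*ʳ (λ i → y i * M i j) (x j)) ⟩
  Σℚ (λ j → Σℚ (λ i → y i * M i j) * x j)         ∎
  where open ≡-Reasoning

·-segment : ∀ {n} (a x y : Vecℚ n) t → a · (λ j → x j + t * (y j - x j)) ≡ a · x + t * (a · y - a · x)
·-segment a x y t = begin
  Σℚ (λ j → a j * (x j + t * (y j - x j)))     ≡⟨ Σℚ-cong (λ j → pointwise (a j) (x j) (y j)) ⟩
  Σℚ (λ j → a j * x j + t * (a j * y j + m j)) ≡⟨ Σℚ-+ (λ j → a j * x j) (λ j → t * (a j * y j + m j)) ⟩
  a · x + Σℚ (λ j → t * (a j * y j + m j))     ≡⟨ cong (a · x +_) (Σℚ-*ˡ t (λ j → a j * y j + m j)) ⟩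
  a · x + t * Σℚ (λ j → a j * y j + m j)       ≡⟨ cong (λ s → a · x + t * s) (Σℚ-+ (λ j → a j * y j) m) ⟩
  a · x + t * (a · y + Σℚ m)                   ≡⟨ cong (λ s → a · x + t * (a · y + s)) (Σℚ-*ˡ (- 1ℚ) (λ j → a j * x j)) ⟩
  a · x + t * (a · y + (- 1ℚ) * a · x)         ≡⟨ solve 3 (λ X Y T → X :+ T :* (Y :+ con (- 1ℚ) :* X) := X :+ T :* (Y :- X)) refl (a · x) (a · y) t ⟩
  a · x + t * (a · y - a · x)                  ∎
  where
  open ≡-Reasoning
  m : Vecℚ _
  m j = (- 1ℚ) * (a j * x j)
  pointwise : ∀ a x y → a * (x + t * (y - x)) ≡ a * x + t * (a * y + (- 1ℚ) * (a * x))
  pointwise a x y = solve 4 (λ a x y t → a :* (x :+ t :* (y :- x)) := a :* x :+ t :* (a :* y :+ con (- 1ℚ) :* (a :* x))) refl a x y t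

·-updateAt-+ : ∀ {n} (u x : Vecℚ n) k δ → u · updateAt x k (_+ δ) ≡ u · x + u k * δ
·-updateAt-+ u x k δ = begin
  u · updateAt x k (_+ δ)
    ≡⟨ Σℚ-update _ _ k (λ l l≢k → cong (u l *_) (updateAt-minimal l k x l≢k)) ⟩
  u · x + (u k * updateAt x k (_+ δ) k - u k * x k)
    ≡⟨ cong (λ z → u · x + (u k * z - u k * x k)) (updateAt-updates k x) ⟩
  u · x + (u k * (x k + δ) - u k * x k)
    ≡⟨ cong (u · x +_) (solve 3 (λ a y d → a :* (y :+ d) :- a :* y := a :* d) refl (u k) (x k) δ) ⟩
  u · x + u k * δ                                       ∎
  where open ≡-Reasoning

·-zeroˡ : ∀ {n} (v : Vecℚ n) → (λ _ → 0ℚ) · v ≡ 0ℚ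
·-zeroˡ {n} v = trans (Σℚ-cong (λ j → ℚP.*-zeroˡ (v j))) (Σℚ-zero n)

·-sub-*ʳ : ∀ {n} (y u v : Vecℚ n) c → y · (λ i → u i - v i * c) ≡ y · u - y · v * c
·-sub-*ʳ y u v c = begin
  Σℚ (λ i → y i * (u i - v i * c))                 ≡⟨ Σℚ-cong (λ i → pointwise (y i) (u i) (v i)) ⟩
  Σℚ (λ i → y i * u i + (- c) * (y i * v i))       ≡⟨ Σℚ-+ (λ i → y i * u i) (λ i → (- c) * (y i * v i)) ⟩
  y · u + Σℚ (λ i → (- c) * (y i * v i))           ≡⟨ cong (y · u +_) (Σℚ-*ˡ (- c) (λ i → y i * v i)) ⟩
  y · u + (- c) * y · v                            ≡⟨ solve 3 (λ a b c → a :+ (:- c) :* b := a :- b :* c) refl (y · u) (y · v) c ⟩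
  y · u - y · v * c                                ∎
  where
  open ≡-Reasoning
  pointwise : ∀ y u v → y * (u - v * c) ≡ y * u + (- c) * (y * v)
  pointwise y u v = solve 4 (λ y u v c → y :* (u :- v :* c) := y :* u :+ (:- c) :* (y :* v)) refl y u v c

·-congʳ : ∀ {n} (y : Vecℚ n) {u v : Vecℚ n} → (∀ i → u i ≡ v i) → y · u ≡ y · v
·-congʳ y u≗v = Σℚ-cong (λ i → cong (y i *_) (u≗v i))

-- Integral and p-adic rationals

IsIntegral-ℤ→ℚ : ∀ a → IsIntegral (ℤ→ℚ a)
IsIntegral-ℤ→ℚ a = a , refl

IsIntegral-+ : ∀ {x y} → IsIntegral x → IsIntegral y → IsIntegral (x + y)
IsIntegral-+ (a , refl) (b , refl) = a ℤ.+ b , sym (ℤ→ℚ-+ a b)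

IsIntegral-* : ∀ {x y} → IsIntegral x → IsIntegral y → IsIntegral (x * y)
IsIntegral-* (a , refl) (b , refl) = a ℤ.* b , sym (ℤ→ℚ-* a b)

IsIntegral-neg : ∀ {x} → IsIntegral x → IsIntegral (- x)
IsIntegral-neg (a , refl) = ℤ.- a , sym (ℤ→ℚ-neg a)

IsIntegral-*denominator : ∀ q → IsIntegral (q * ℕ→ℚ (ℚ.↧ₙ q))
IsIntegral-*denominator q = ℚ.↥ q , Equivalence.from (*ℕ→ℚ≡ℤ→ℚ⇔ q (ℚ.↧ₙ q) (ℚ.↥ q)) refl

module _ (p : ℕ) where

  IsPAdic-ℤ→ℚ : ∀ a → IsPAdic p (ℤ→ℚ a)
  IsPAdic-ℤ→ℚ a = a , 0 , ℚP.*-identityʳ _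

  IsPAdic-+ : ∀ {x y} → IsPAdic p x → IsPAdic p y → IsPAdic p (x + y)
  IsPAdic-+ {x} {y} (a , k , x*pᵏ≡a) (b , l , y*pˡ≡b) = a ℤ.* ℤ.+ (p ^ l) ℤ.+ b ℤ.* ℤ.+ (p ^ k) , k ℕ.+ l , (begin
    (x + y) * ℕ→ℚ (p ^ (k ℕ.+ l))
      ≡⟨ cong (λ e → (x + y) * ℕ→ℚ e) (ℕP.^-distribˡ-+-* p k l) ⟩
    (x + y) * ℕ→ℚ (p ^ k ℕ.* p ^ l)
      ≡⟨ cong ((x + y) *_) (ℕ→ℚ-* (p ^ k) (p ^ l)) ⟩
    (x + y) * (ℕ→ℚ (p ^ k) * ℕ→ℚ (p ^ l))
      ≡⟨ solve 4 (λ x y K L → (x :+ y) :* (K :* L) := (x :* K) :* L :+ (y :* L) :* K) refl x y (ℕ→ℚ (p ^ k)) (ℕ→ℚ (p ^ l)) ⟩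
    (x * ℕ→ℚ (p ^ k)) * ℕ→ℚ (p ^ l) + (y * ℕ→ℚ (p ^ l)) * ℕ→ℚ (p ^ k)
      ≡⟨ cong₂ (λ u v → u * ℕ→ℚ (p ^ l) + v * ℕ→ℚ (p ^ k)) x*pᵏ≡a y*pˡ≡b ⟩
    ℤ→ℚ a * ℕ→ℚ (p ^ l) + ℤ→ℚ b * ℕ→ℚ (p ^ k)
      ≡⟨ sym (cong₂ _+_ (ℤ→ℚ-* a _) (ℤ→ℚ-* b _)) ⟩
    ℤ→ℚ (a ℤ.* ℤ.+ (p ^ l)) + ℤ→ℚ (b ℤ.* ℤ.+ (p ^ k))
      ≡⟨ sym (ℤ→ℚ-+ (a ℤ.* ℤ.+ (p ^ l)) (b ℤ.* ℤ.+ (p ^ k))) ⟩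
    ℤ→ℚ (a ℤ.* ℤ.+ (p ^ l) ℤ.+ b ℤ.* ℤ.+ (p ^ k))        ∎)
    where open ≡-Reasoning

  IsPAdic-integral* : ∀ {z x} → IsIntegral z → IsPAdic p x → IsPAdic p (z * x)
  IsPAdic-integral* {x = x} (c , refl) (a , k , x*pᵏ≡a) =
    c ℤ.* a , k , trans (ℚP.*-assoc (ℤ→ℚ c) x _) (trans (cong (ℤ→ℚ c *_) x*pᵏ≡a) (sym (ℤ→ℚ-* c a)))

  IsPAdic⇒↧∣p^ : ∀ {q} → IsPAdic p q → ∃ λ k → ℚ.↧ₙ q ∣ p ^ k
  IsPAdic⇒↧∣p^ {q@(mkℚ n _ coprime)} (a , k , eq) =
    k , ℕC.coprime-divisor (ℕC.sym (ℕC.recompute coprime)) (divides ℤ.∣ a ∣ (begin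
      ℤ.∣ n ∣ ℕ.* p ^ k               ≡⟨ ℤP.abs-* n (ℤ.+ (p ^ k)) ⟨
      ℤ.∣ n ℤ.* ℤ.+ (p ^ k) ∣           ≡⟨ cong ℤ.∣_∣ (Equivalence.to (*ℕ→ℚ≡ℤ→ℚ⇔ q (p ^ k) a) eq) ⟩
      ℤ.∣ a ℤ.* ℚ.↧ q ∣               ≡⟨ ℤP.abs-* a (ℚ.↧ q) ⟩
      ℤ.∣ a ∣ ℕ.* ℚ.↧ₙ q              ∎))
    where open ≡-Reasoning

  ↧∣p^⇒IsPAdic : ∀ {q} k → ℚ.↧ₙ q ∣ p ^ k → IsPAdic p q
  ↧∣p^⇒IsPAdic {q} k (divides c pᵏ≡c*↧) = ℚ.↥ q ℤ.* ℤ.+ c , k , Equivalence.from (*ℕ→ℚ≡ℤ→ℚ⇔ q (p ^ k) (ℚ.↥ q ℤ.* ℤ.+ c)) (begin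
    ℚ.↥ q ℤ.* ℤ.+ (p ^ k)                ≡⟨ cong (λ e → ℚ.↥ q ℤ.* ℤ.+ e) pᵏ≡c*↧ ⟩
    ℚ.↥ q ℤ.* ℤ.+ (c ℕ.* ℚ.↧ₙ q)         ≡⟨ cong (ℚ.↥ q ℤ.*_) (ℤP.pos-* c (ℚ.↧ₙ q)) ⟩
    ℚ.↥ q ℤ.* (ℤ.+ c ℤ.* ℚ.↧ q)          ≡⟨ ℤP.*-assoc (ℚ.↥ q) (ℤ.+ c) (ℚ.↧ q) ⟨
    ℚ.↥ q ℤ.* ℤ.+ c ℤ.* ℚ.↧ q            ∎)
    where open ≡-Reasoning

IsIntegral-ℕ→ℚ : ∀ n → IsIntegral (ℕ→ℚ n)
IsIntegral-ℕ→ℚ n = ℤ.+ n , refl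

IsPAdic-· : ∀ p {n} {u x : Vecℚ n} → (∀ j → IsIntegral (u j)) → IsPAdicPoint p x → IsPAdic p (u · x)
IsPAdic-· p {zero}  _          _       = IsPAdic-ℤ→ℚ p 0ℤ
IsPAdic-· p {suc n} {u} {x} u-integral x-pAdic =
  IsPAdic-+ p {u zero * x zero} (IsPAdic-integral* p {x = x zero} (u-integral zero) (x-pAdic zero))
    (IsPAdic-· p {u = u ∘ suc} {x ∘ suc} (u-integral ∘ suc) (x-pAdic ∘ suc))

coprime∧∣^⇒∣1 : ∀ {d p} k → Coprime d p → d ∣ p ^ k → d ∣ 1
coprime∧∣^⇒∣1 zero    _       d∣1   = d∣1
coprime∧∣^⇒∣1 (suc k) coprime d∣pᵏ⁺¹ = coprime∧∣^⇒∣1 k coprime (ℕC.coprime-divisor coprime d∣pᵏ⁺¹)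

^-monoʳ-∣ : ∀ p {m n} → m ℕ.≤ n → p ^ m ∣ p ^ n
^-monoʳ-∣ p {m} {n} m≤n = divides (p ^ (n ℕ.∸ m)) (begin
  p ^ n                        ≡⟨ cong (p ^_) (ℕP.m+[n∸m]≡n m≤n) ⟨
  p ^ (m ℕ.+ (n ℕ.∸ m))        ≡⟨ ℕP.^-distribˡ-+-* p m (n ℕ.∸ m) ⟩
  p ^ m ℕ.* p ^ (n ℕ.∸ m)      ≡⟨ ℕP.*-comm (p ^ m) _ ⟩
  p ^ (n ℕ.∸ m) ℕ.* p ^ m      ∎)
  where open ≡-Reasoning

module _ {p : ℕ} (p-prime : Prime p) where

  ¬∣⇒coprime : ∀ {d} → ¬ p ∣ d → Coprime d p
  ¬∣⇒coprime p∤d (e∣d , e∣p) with prime⇒irreducible p-prime e∣p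
  ... | inj₁ e≡1 = e≡1
  ... | inj₂ refl = contradiction e∣d p∤d

  -- A divisor d of a power of p is a power of p with exponent below d.
  ∣p^⇒∣p^self : ∀ k {d} → .{{NonZero d}} → d ∣ p ^ k → d ∣ p ^ d
  ∣p^⇒∣p^self zero    d∣1 rewrite ℕD.∣1⇒≡1 d∣1 = ℕD.1∣ _
  ∣p^⇒∣p^self (suc k) {d} d∣pᵏ⁺¹ with p ∣? d
  ... | no p∤d = ℕD.∣-trans (coprime∧∣^⇒∣1 (suc k) (¬∣⇒coprime p∤d) d∣pᵏ⁺¹) (ℕD.1∣ _)
  ... | yes (divides e refl) = ℕD.∣-trans (ℕD.*-monoˡ-∣ p e∣pᵉ) (ℕD.∣-trans p^e*p∣p^[e+1] (^-monoʳ-∣ p 1+e≤e*p))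
    where
    instance
      _ = prime⇒nonZero p-prime
      _ = ℕP.m*n≢0⇒m≢0 e
    e∣pᵉ : e ∣ p ^ e
    e∣pᵉ = ∣p^⇒∣p^self k (ℕD.*-cancelʳ-∣ p (subst (e ℕ.* p ∣_) (ℕP.*-comm p (p ^ k)) d∣pᵏ⁺¹))
    p^e*p∣p^[e+1] : p ^ e ℕ.* p ∣ p ^ suc e
    p^e*p∣p^[e+1] = ℕD.∣-reflexive (ℕP.*-comm (p ^ e) p)
    1+e≤e*p : suc e ℕ.≤ e ℕ.* p
    1+e≤e*p = begin
      suc e          ≤⟨ ℕP.+-monoˡ-≤ e (ℕ.>-nonZero⁻¹ e) ⟩
      e ℕ.+ e        ≡⟨ cong (e ℕ.+_) (ℕP.+-identityʳ e) ⟨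
      2 ℕ.* e        ≤⟨ ℕP.*-monoˡ-≤ e (ℕ.nonTrivial⇒n>1 p {{prime⇒nonTrivial p-prime}}) ⟩
      p ℕ.* e        ≡⟨ ℕP.*-comm p e ⟩
      e ℕ.* p        ∎
      where open ℕP.≤-Reasoning

  IsPAdic? : ∀ q → Dec (IsPAdic p q)
  IsPAdic? q@(mkℚ _ d _) = map′ (↧∣p^⇒IsPAdic p {q} (suc d)) from (suc d ∣? p ^ suc d)
    where
    from : IsPAdic p q → suc d ∣ p ^ suc d
    from p-adic with IsPAdic⇒↧∣p^ p {q} p-adic
    ... | k , ↧∣pᵏ = ∣p^⇒∣p^self k ↧∣pᵏ

1/[1+_] : ℕ → ℚ
1/[1+ p ] = mkℚ (ℤ.+ 1) p (ℕC.1-coprimeTo (suc p))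

¬IsPAdic-1/[1+p] : ∀ {p} → .{{NonZero p}} → ¬ IsPAdic p 1/[1+ p ]
¬IsPAdic-1/[1+p] {p} p-adic with IsPAdic⇒↧∣p^ p {1/[1+ p ]} p-adic
... | k , 1+p∣pᵏ = ℕ.≢-nonZero⁻¹ p (ℕP.suc-injective (ℕD.∣1⇒≡1 (coprime∧∣^⇒∣1 k 1+p⊥p 1+p∣pᵏ)))
  where
  1+p⊥p : Coprime (suc p) p
  1+p⊥p = subst (λ n → Coprime n p) (ℕP.+-comm p 1) (ℕC.coprime-+ (ℕC.1-coprimeTo p))

common-denominator : ∀ {n} (v : Vecℚ n) → ∃ λ D → NonZero D × (∀ j → IsIntegral (v j * ℕ→ℚ D))
common-denominator {zero}  v = 1 , _ , λ ()
common-denominator {suc n} v with common-denominator (λ j → v (suc j))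
... | D , D≢0 , integral = ℚ.↧ₙ (v zero) ℕ.* D , ℕP.m*n≢0 (ℚ.↧ₙ (v zero)) D {{_}} {{D≢0}} , λ
  { zero    → subst IsIntegral (reassoc (v zero) (ℚ.↧ₙ (v zero)) D) (IsIntegral-* (IsIntegral-*denominator (v zero)) (IsIntegral-ℕ→ℚ D))
  ; (suc j) → subst IsIntegral (trans (reassoc (v (suc j)) D (ℚ.↧ₙ (v zero))) (cong (λ e → v (suc j) * ℕ→ℚ e) (ℕP.*-comm D _)))
                (IsIntegral-* (integral j) (IsIntegral-ℕ→ℚ (ℚ.↧ₙ (v zero)))) }
  where
  reassoc : ∀ q a b → q * ℕ→ℚ a * ℕ→ℚ b ≡ q * ℕ→ℚ (a ℕ.* b)
  reassoc q a b = trans (ℚP.*-assoc q (ℕ→ℚ a) (ℕ→ℚ b)) (cong (q *_) (sym (ℕ→ℚ-* a b)))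

n<p^n : ∀ {p} → 1 ℕ.< p → ∀ n → n ℕ.< p ^ n
n<p^n 1<p zero    = ℕ.s≤s ℕ.z≤n
n<p^n {p} 1<p (suc n) = ℕP.≤-<-trans (n<p^n 1<p n) (ℕP.^-monoʳ-< p 1<p (ℕP.n<1+n n))

1/[1+r]*[1+r]≡1 : ∀ r → 1/[1+ r ] * ℕ→ℚ (suc r) ≡ 1ℚ
1/[1+r]*[1+r]≡1 r = Equivalence.from (*ℕ→ℚ≡ℤ→ℚ⇔ 1/[1+ r ] (suc r) (ℤ.+ 1)) refl

[1+r]*[1/[1+r]*a]≡a : ∀ r a → ℕ→ℚ (suc r) * (1/[1+ r ] * a) ≡ a
[1+r]*[1/[1+r]*a]≡a r a = begin
  ℕ→ℚ (suc r) * (1/[1+ r ] * a)   ≡⟨ ℚP.*-assoc (ℕ→ℚ (suc r)) 1/[1+ r ] a ⟨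
  ℕ→ℚ (suc r) * 1/[1+ r ] * a     ≡⟨ cong (_* a) (trans (ℚP.*-comm (ℕ→ℚ (suc r)) 1/[1+ r ]) (1/[1+r]*[1+r]≡1 r)) ⟩
  1ℚ * a                          ≡⟨ ℚP.*-identityˡ a ⟩
  a                               ∎
  where open ≡-Reasoning

mean : ∀ {r} → (Fin (suc r) → ℚ) → ℚ
mean {r} f = (λ _ → 1/[1+ r ]) · f

mean-const : ∀ r c → mean {r} (λ _ → c) ≡ c
mean-const r c = trans (Σℚ-const (suc r) (1/[1+ r ] * c)) ([1+r]*[1/[1+r]*a]≡a r c)

mean-≤ : ∀ {r c} {f : Fin (suc r) → ℚ} → (∀ k → f k ≤ c) → mean f ≤ c
mean-≤ {r} {c} {f} f≤c = subst (mean f ≤_) (mean-const r c) (Σℚ-mono-≤ (λ k → ℚP.*-monoˡ-≤-nonNeg 1/[1+ r ] (f≤c k)))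

mean-≡⇒≡ : ∀ {r c} {f : Fin (suc r) → ℚ} → (∀ k → f k ≤ c) → mean f ≡ c → ∀ k → f k ≡ c
mean-≡⇒≡ {r} {c} {f} f≤c mean≡c k = begin
  f k                                 ≡⟨ [1+r]*[1/[1+r]*a]≡a r (f k) ⟨
  ℕ→ℚ (suc r) * (1/[1+ r ] * f k)     ≡⟨ cong (ℕ→ℚ (suc r) *_) (Σℚ-≤-≡⇒≡ wf≤wc (trans mean≡c (sym (mean-const r c))) k) ⟩
  ℕ→ℚ (suc r) * (1/[1+ r ] * c)       ≡⟨ [1+r]*[1/[1+r]*a]≡a r c ⟩
  c                                   ∎
  where
  open ≡-Reasoning
  wf≤wc : ∀ k → 1/[1+ r ] * f k ≤ 1/[1+ r ] * c
  wf≤wc k = ℚP.*-monoˡ-≤-nonNeg 1/[1+ r ] (f≤c k)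

·-combination : ∀ {n r} (a : Vecℚ n) (μ : Vecℚ r) (v : Fin r → Vecℚ n) →
                a · (λ j → μ · (λ k → v k j)) ≡ μ · (λ k → a · v k)
·-combination a μ v = begin
  a · (λ j → μ · (λ k → v k j))   ≡⟨ ·-comm a _ ⟩
  (λ j → μ · (λ k → v k j)) · a   ≡⟨ ·-swap μ v a ⟨
  μ · (λ k → v k · a)             ≡⟨ Σℚ-cong (λ k → cong (μ k *_) (·-comm (v k) a)) ⟩
  μ · (λ k → a · v k)             ∎
  where open ≡-Reasoning

centroid : ∀ {n r} → (Fin (suc r) → Vecℚ n) → Vecℚ n
centroid v j = mean (λ k → v k j)

-- A p-adic Farkas lemma

updateAt-All : ∀ {A : Set} (P : A → Set) {n} (xs : Fin n → A) j {f : A → A} →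
               (∀ l → P (xs l)) → P (f (xs j)) → ∀ l → P (updateAt xs j f l)
updateAt-All P xs zero    all pf zero    = pf
updateAt-All P xs zero    all pf (suc l) = all (suc l)
updateAt-All P xs (suc j) all pf zero    = all zero
updateAt-All P xs (suc j) all pf (suc l) = updateAt-All P (tail xs) j (all ∘ suc) pf l

Matrix : ℕ → ℕ → Set
Matrix m n = Fin m → Fin n → ℤ

row : ∀ {m n} → Matrix m n → Fin m → Vecℚ n
row A i j = ℤ→ℚ (A i j)

column : ∀ {m n} → Matrix m n → Fin n → Vecℚ m
column A j i = ℤ→ℚ (A i j)

addColumn : ∀ {m n} → Matrix m n → (j k : Fin n) → ℤ → Matrix m n
addColumn A j k s i = updateAt (A i) j (ℤ._+ s ℤ.* A i k)

module _ {m n} (A : Matrix m n) {j k : Fin n} (s : ℤ) where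

  column-addColumn-≢ : ∀ {l} → l ≢ j → ∀ i → column (addColumn A j k s) l i ≡ column A l i
  column-addColumn-≢ {l} l≢j i = cong ℤ→ℚ (updateAt-minimal l j (A i) l≢j)

  column-addColumn : ∀ i → column (addColumn A j k s) j i ≡ column A j i + ℤ→ℚ s * column A k i
  column-addColumn i = begin
    ℤ→ℚ (updateAt (A i) j (ℤ._+ s ℤ.* A i k) j)  ≡⟨ cong ℤ→ℚ (updateAt-updates j (A i)) ⟩
    ℤ→ℚ (A i j ℤ.+ s ℤ.* A i k)                  ≡⟨ ℤ→ℚ-+ (A i j) (s ℤ.* A i k) ⟩
    ℤ→ℚ (A i j) + ℤ→ℚ (s ℤ.* A i k)              ≡⟨ cong (ℤ→ℚ (A i j) +_) (ℤ→ℚ-* s (A i k)) ⟩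
    ℤ→ℚ (A i j) + ℤ→ℚ s * ℤ→ℚ (A i k)            ∎
    where open ≡-Reasoning

  ·-column-addColumn : ∀ y → y · column (addColumn A j k s) j ≡ y · column A j + ℤ→ℚ s * y · column A k
  ·-column-addColumn y = begin
    Σℚ (λ i → y i * column (addColumn A j k s) j i)                 ≡⟨ Σℚ-cong (λ i → cong (y i *_) (column-addColumn i)) ⟩
    Σℚ (λ i → y i * (column A j i + ℤ→ℚ s * column A k i))          ≡⟨ Σℚ-cong (λ i → distrib (y i) (column A j i) (column A k i)) ⟩
    Σℚ (λ i → y i * column A j i + ℤ→ℚ s * (y i * column A k i))    ≡⟨ Σℚ-+ _ (λ i → ℤ→ℚ s * (y i * column A k i)) ⟩
    y · column A j + Σℚ (λ i → ℤ→ℚ s * (y i * column A k i))        ≡⟨ cong (y · column A j +_) (Σℚ-*ˡ (ℤ→ℚ s) (λ i → y i * column A k i)) ⟩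
    y · column A j + ℤ→ℚ s * y · column A k                         ∎
    where
    open ≡-Reasoning
    distrib : ∀ a b c → a * (b + ℤ→ℚ s * c) ≡ a * b + ℤ→ℚ s * (a * c)
    distrib a b c = solve 4 (λ a b c s → a :* (b :+ s :* c) := a :* b :+ s :* (a :* c)) refl a b c (ℤ→ℚ s)

  row-addColumn-· : ∀ i x → row (addColumn A j k s) i · x ≡ row A i · x + ℤ→ℚ s * ℤ→ℚ (A i k) * x j
  row-addColumn-· i x = begin
    row (addColumn A j k s) i · x
      ≡⟨ Σℚ-update _ _ j (λ l l≢j → cong (_* x l) (column-addColumn-≢ l≢j i)) ⟩
    row A i · x + (column (addColumn A j k s) j i * x j - ℤ→ℚ (A i j) * x j)
      ≡⟨ cong (λ z → row A i · x + (z * x j - ℤ→ℚ (A i j) * x j)) (column-addColumn i) ⟩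
    row A i · x + ((ℤ→ℚ (A i j) + ℤ→ℚ s * ℤ→ℚ (A i k)) * x j - ℤ→ℚ (A i j) * x j)
      ≡⟨ cong (row A i · x +_) (solve 4 (λ a s b y → (a :+ s :* b) :* y :- a :* y := s :* b :* y) refl (ℤ→ℚ (A i j)) (ℤ→ℚ s) (ℤ→ℚ (A i k)) (x j)) ⟩
    row A i · x + ℤ→ℚ s * ℤ→ℚ (A i k) * x j                                ∎
    where open ≡-Reasoning

module _ (p : ℕ) where

  FarkasCondition : ∀ {m n} → Matrix m n → Vecℚ m → Set
  FarkasCondition A b = ∀ y → (∀ j → IsIntegral (y · column A j)) → IsPAdic p (y · b)

  PAdicSolution : ∀ {m n} → Matrix m n → Vecℚ m → Set
  PAdicSolution {n = n} A b = Σ (Vecℚ n) λ x → IsPAdicPoint p x × (∀ i → row A i · x ≡ b i)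

  pAdicSolution⇒farkasCondition : ∀ {m n} {A : Matrix m n} {b} → PAdicSolution A b → FarkasCondition A b
  pAdicSolution⇒farkasCondition {A = A} (x , x-pAdic , Ax≡b) y y·A-integral =
    subst (IsPAdic p) (trans (sym (·-swap y (row A) x)) (·-congʳ y Ax≡b)) (IsPAdic-· p y·A-integral x-pAdic)

  module _ {m n} (A : Matrix m n) (b : Vecℚ m) {j k : Fin n} (s : ℤ) (j≢k : j ≢ k) where

    FarkasCondition-addColumn : FarkasCondition A b → FarkasCondition (addColumn A j k s) b
    FarkasCondition-addColumn cond y y·A′-integral = cond y y·A-integral
      where
      y·column-k : y · column (addColumn A j k s) k ≡ y · column A k
      y·column-k = Σℚ-cong (λ i → cong (y i *_) (column-addColumn-≢ A s (j≢k ∘ sym) i))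
      y·A-integral : ∀ l → IsIntegral (y · column A l)
      y·A-integral l with l FinP.≟ j
      ... | no l≢j = subst IsIntegral (Σℚ-cong (λ i → cong (y i *_) (column-addColumn-≢ A s l≢j i))) (y·A′-integral l)
      ... | yes refl = subst IsIntegral undo
            (IsIntegral-+ (y·A′-integral j) (IsIntegral-* (IsIntegral-neg (IsIntegral-ℤ→ℚ s)) (y·A′-integral k)))
        where
        undo : y · column (addColumn A j k s) j + (- ℤ→ℚ s) * y · column (addColumn A j k s) k ≡ y · column A j
        undo = trans (cong₂ (λ u v → u + (- ℤ→ℚ s) * v) (·-column-addColumn A s y) y·column-k)
                     (solve 3 (λ u s v → u :+ s :* v :+ (:- s) :* v := u) refl (y · column A j) (ℤ→ℚ s) (y · column A k))

    PAdicSolution-addColumn : PAdicSolution (addColumn A j k s) b → PAdicSolution A b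
    PAdicSolution-addColumn (x′ , x′-pAdic , A′x′≡b) = x , x-pAdic , λ i → trans (same-rows i) (A′x′≡b i)
      where
      x : Vecℚ n
      x = updateAt x′ k (_+ ℤ→ℚ s * x′ j)
      x-pAdic : IsPAdicPoint p x
      x-pAdic = updateAt-All (IsPAdic p) x′ k x′-pAdic
                  (IsPAdic-+ p {x′ k} (x′-pAdic k) (IsPAdic-integral* p {x = x′ j} (IsIntegral-ℤ→ℚ s) (x′-pAdic j)))
      same-rows : ∀ i → row A i · x ≡ row (addColumn A j k s) i · x′
      same-rows i = begin
        row A i · x
          ≡⟨ ·-updateAt-+ (row A i) x′ k (ℤ→ℚ s * x′ j) ⟩
        row A i · x′ + ℤ→ℚ (A i k) * (ℤ→ℚ s * x′ j)
          ≡⟨ cong (row A i · x′ +_) (solve 3 (λ a s y → a :* (s :* y) := s :* a :* y) refl (ℤ→ℚ (A i k)) (ℤ→ℚ s) (x′ j)) ⟩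
        row A i · x′ + ℤ→ℚ s * ℤ→ℚ (A i k) * x′ j
          ≡⟨ row-addColumn-· A s i x′ ⟨
        row (addColumn A j k s) i · x′                  ∎
        where open ≡-Reasoning

‖_‖₁ : ∀ {n} → (Fin n → ℤ) → ℕ
‖_‖₁ {zero}  a = 0
‖_‖₁ {suc n} a = ∣ a zero ∣ ℕ.+ ‖ tail a ‖₁

‖‖₁-updateAt-< : ∀ {n} (a : Fin n → ℤ) j {f : ℤ → ℤ} → ∣ f (a j) ∣ ℕ.< ∣ a j ∣ → ‖ updateAt a j f ‖₁ ℕ.< ‖ a ‖₁
‖‖₁-updateAt-< a zero    lt = ℕP.+-monoˡ-< ‖ tail a ‖₁ lt
‖‖₁-updateAt-< a (suc j) lt = ℕP.+-monoʳ-< ∣ a zero ∣ (‖‖₁-updateAt-< (tail a) j lt)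

∣u-[u/v]*v∣<∣v∣ : ∀ u v .{{_ : ℤ.NonZero v}} → ∣ u ℤ.+ ℤ.- (u ℤ./ v) ℤ.* v ∣ ℕ.< ∣ v ∣
∣u-[u/v]*v∣<∣v∣ u v = subst (ℕ._< ∣ v ∣) (cong ∣_∣ (sym u-[u/v]*v≡u%v)) (n%d<d u v)
  where
  r q : ℤ
  r = ℤ.+ (u ℤ.% v)
  q = u ℤ./ v
  u-[u/v]*v≡u%v : u ℤ.+ ℤ.- q ℤ.* v ≡ r
  u-[u/v]*v≡u%v = begin
    u ℤ.+ ℤ.- q ℤ.* v                   ≡⟨ cong₂ ℤ._+_ (a≡a%n+[a/n]*n u v) (sym (ℤP.neg-distribˡ-* q v)) ⟩
    r ℤ.+ q ℤ.* v ℤ.+ ℤ.- (q ℤ.* v)     ≡⟨ ℤP.+-assoc r (q ℤ.* v) _ ⟩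
    r ℤ.+ (q ℤ.* v ℤ.+ ℤ.- (q ℤ.* v))   ≡⟨ cong (ℤ._+_ r) (ℤP.+-inverseʳ (q ℤ.* v)) ⟩
    r ℤ.+ 0ℤ                            ≡⟨ ℤP.+-identityʳ r ⟩
    r                                   ∎
    where open ≡-Reasoning

data RowShape {n} (a : Fin n → ℤ) : Set where
  zeroRow      : (∀ l → a l ≡ 0ℤ) → RowShape a
  pivotRow     : ∀ j → a j ≢ 0ℤ → (∀ l → l ≢ j → a l ≡ 0ℤ) → RowShape a
  reducibleRow : ∀ j k → j ≢ k → a k ≢ 0ℤ → ∣ a k ∣ ℕ.≤ ∣ a j ∣ → RowShape a

rowShape : ∀ {n} (a : Fin n → ℤ) → RowShape a
rowShape {zero}  a = zeroRow λ ()
rowShape {suc n} a with rowShape (tail a) | a zero ℤ.≟ 0ℤ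
... | zeroRow tail≡0 | yes a₀≡0 = zeroRow λ { zero → a₀≡0 ; (suc l) → tail≡0 l }
... | zeroRow tail≡0 | no  a₀≢0 = pivotRow zero a₀≢0 λ { zero 0≢0 → contradiction refl 0≢0 ; (suc l) _ → tail≡0 l }
... | pivotRow j aⱼ≢0 others | yes a₀≡0 =
      pivotRow (suc j) aⱼ≢0 λ { zero _ → a₀≡0 ; (suc l) l≢j → others l (l≢j ∘ cong suc) }
... | pivotRow j aⱼ≢0 others | no a₀≢0 with ∣ a (suc j) ∣ ℕP.≤? ∣ a zero ∣
...   | yes ∣aⱼ∣≤∣a₀∣ = reducibleRow zero (suc j) (λ ()) aⱼ≢0 ∣aⱼ∣≤∣a₀∣
...   | no  ∣aⱼ∣≰∣a₀∣ = reducibleRow (suc j) zero (λ ()) a₀≢0 (ℕP.<⇒≤ (ℕP.≰⇒> ∣aⱼ∣≰∣a₀∣))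
rowShape {suc n} a | reducibleRow j k j≢k aₖ≢0 ∣aₖ∣≤∣aⱼ∣ | _ =
  reducibleRow (suc j) (suc k) (j≢k ∘ FinP.suc-injective) aₖ≢0 ∣aₖ∣≤∣aⱼ∣

module _ {p : ℕ} {m n} (A : Matrix (suc m) n) (b : Vecℚ (suc m)) where

  FarkasCondition-tail : FarkasCondition p A b → FarkasCondition p (tail A) (tail b)
  FarkasCondition-tail cond y y·A-integral = subst (IsPAdic p) (drop-0 b) (cond (0ℚ ∷ y) (λ l → subst IsIntegral (sym (drop-0 (column A l))) (y·A-integral l)))
    where
    drop-0 : ∀ v → (0ℚ ∷ y) · v ≡ y · tail v
    drop-0 v = trans (cong (_+ y · tail v) (ℚP.*-zeroˡ (v zero))) (ℚP.+-identityˡ _)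

  module _ (A₀≡0 : ∀ l → A zero l ≡ 0ℤ) where

    -- A nonzero b₀ could be rescaled to the non-p-adic value 1/(1+p) by a dual vector.
    zeroRow⇒b₀≡0 : .{{ℕ.NonZero p}} → FarkasCondition p A b → b zero ≡ 0ℚ
    zeroRow⇒b₀≡0 cond with b zero ℚP.≟ 0ℚ
    ... | yes b₀≡0 = b₀≡0
    ... | no  b₀≢0 = contradiction (subst (IsPAdic p) y·b≡c (cond y y·A-integral)) ¬IsPAdic-1/[1+p]
      where
      instance _ = ℚ.≢-nonZero b₀≢0
      c : ℚ
      c = 1/[1+ p ]
      y : Vecℚ (suc m)
      y = c * 1/ b zero ∷ λ _ → 0ℚ
      y·A-integral : ∀ l → IsIntegral (y · column A l)
      y·A-integral l = 0ℤ , (begin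
        c * 1/ b zero * ℤ→ℚ (A zero l) + (λ _ → 0ℚ) · tail (column A l)
          ≡⟨ cong₂ (λ a z → c * 1/ b zero * ℤ→ℚ a + z) (A₀≡0 l) (·-zeroˡ (tail (column A l))) ⟩
        c * 1/ b zero * 0ℚ + 0ℚ
          ≡⟨ solve 1 (λ a → a :* con 0ℚ :+ con 0ℚ := con 0ℚ) refl (c * 1/ b zero) ⟩
        0ℚ                                                                ∎)
        where open ≡-Reasoning
      y·b≡c : y · b ≡ c
      y·b≡c = begin
        c * 1/ b zero * b zero + (λ _ → 0ℚ) · tail b   ≡⟨ cong (c * 1/ b zero * b zero +_) (·-zeroˡ (tail b)) ⟩
        c * 1/ b zero * b zero + 0ℚ                    ≡⟨ solve 3 (λ c i b → c :* i :* b :+ con 0ℚ := c :* (i :* b)) refl c (1/ b zero) (b zero) ⟩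
        c * (1/ b zero * b zero)                       ≡⟨ cong (c *_) (ℚP.*-inverseˡ (b zero)) ⟩
        c * 1ℚ                                         ≡⟨ ℚP.*-identityʳ c ⟩
        c                                              ∎
        where open ≡-Reasoning

    PAdicSolution-zeroRow : b zero ≡ 0ℚ → PAdicSolution p (tail A) (tail b) → PAdicSolution p A b
    PAdicSolution-zeroRow b₀≡0 (x , x-pAdic , Ax≡b) = x , x-pAdic , λ
      { zero    → trans (trans (Σℚ-cong (λ l → cong (λ a → ℤ→ℚ a * x l) (A₀≡0 l))) (·-zeroˡ x)) (sym b₀≡0)
      ; (suc i) → Ax≡b i }

module Pivot {p : ℕ} {m n} (A : Matrix (suc m) n) (b : Vecℚ (suc m)) {j : Fin n}
             (Aⱼ≢0 : A zero j ≢ 0ℤ) (others : ∀ l → l ≢ j → A zero l ≡ 0ℤ) where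

  α : ℚ
  α = ℤ→ℚ (A zero j)

  instance
    α≢0 : ℚ.NonZero α
    α≢0 = ℚ.≢-nonZero (Aⱼ≢0 ∘ ℤ→ℚ-injective)

  xⱼ : ℚ
  xⱼ = b zero * 1/ α

  eliminated : Matrix m n
  eliminated i = updateAt (A (suc i)) j (const 0ℤ)

  eliminatedRhs : Vecℚ m
  eliminatedRhs i = b (suc i) - column A j (suc i) * xⱼ

  ·-column-≢ : ∀ c y {l} → l ≢ j → (c ∷ y) · column A l ≡ y · column eliminated l
  ·-column-≢ c y {l} l≢j = begin
    c * ℤ→ℚ (A zero l) + y · tail (column A l)  ≡⟨ cong (λ a → c * ℤ→ℚ a + y · tail (column A l)) (others l l≢j) ⟩
    c * 0ℚ + y · tail (column A l)              ≡⟨ cong (_+ y · tail (column A l)) (ℚP.*-zeroʳ c) ⟩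
    0ℚ + y · tail (column A l)                  ≡⟨ ℚP.+-identityˡ _ ⟩
    y · tail (column A l)                       ≡⟨ Σℚ-cong (λ i → cong (λ a → y i * ℤ→ℚ a) (updateAt-minimal l j (A (suc i)) l≢j)) ⟨
    y · column eliminated l                     ∎
    where open ≡-Reasoning

  xⱼ-pAdic : FarkasCondition p A b → IsPAdic p xⱼ
  xⱼ-pAdic cond = subst (IsPAdic p) y·b≡xⱼ (cond y y·A-integral)
    where
    y : Vecℚ (suc m)
    y = 1/ α ∷ λ _ → 0ℚ
    y·A-integral : ∀ l → IsIntegral (y · column A l)
    y·A-integral l with l FinP.≟ j
    ... | no l≢j = subst IsIntegral (sym (trans (·-column-≢ (1/ α) (λ _ → 0ℚ) l≢j) (·-zeroˡ (column eliminated l)))) (IsIntegral-ℤ→ℚ 0ℤ)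
    ... | yes refl = subst IsIntegral (sym (begin
      1/ α * α + (λ _ → 0ℚ) · tail (column A j)  ≡⟨ cong₂ _+_ (ℚP.*-inverseˡ α) (·-zeroˡ (tail (column A j))) ⟩
      1ℚ + 0ℚ                                   ≡⟨ ℚP.+-identityʳ 1ℚ ⟩
      1ℚ                                        ∎)) (IsIntegral-ℤ→ℚ (ℤ.+ 1))
      where open ≡-Reasoning
    y·b≡xⱼ : y · b ≡ xⱼ
    y·b≡xⱼ = trans (cong₂ _+_ (ℚP.*-comm (1/ α) (b zero)) (·-zeroˡ (tail b))) (ℚP.+-identityʳ xⱼ)

  -- The first coordinate of the dual vector is chosen to cancel the pivot column.
  FarkasCondition-eliminated : FarkasCondition p A b → FarkasCondition p eliminated eliminatedRhs
  FarkasCondition-eliminated cond y y·A″-integral = subst (IsPAdic p) y′·b≡y·b″ (cond y′ y′·A-integral)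
    where
    σ τ : ℚ
    σ = y · tail (column A j)
    τ = - (σ * 1/ α)
    y′ : Vecℚ (suc m)
    y′ = τ ∷ y
    y′·A-integral : ∀ l → IsIntegral (y′ · column A l)
    y′·A-integral l with l FinP.≟ j
    ... | no l≢j = subst IsIntegral (sym (·-column-≢ τ y l≢j)) (y·A″-integral l)
    ... | yes refl = 0ℤ , (begin
      τ * α + σ                  ≡⟨ solve 3 (λ s i a → (:- (s :* i)) :* a :+ s := s :* (con 1ℚ :- i :* a)) refl σ (1/ α) α ⟩
      σ * (1ℚ - 1/ α * α)        ≡⟨ cong (λ z → σ * (1ℚ - z)) (ℚP.*-inverseˡ α) ⟩
      σ * (1ℚ - 1ℚ)              ≡⟨ solve 1 (λ s → s :* (con 1ℚ :- con 1ℚ) := con 0ℚ) refl σ ⟩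
      0ℚ                         ∎)
      where open ≡-Reasoning
    y′·b≡y·b″ : y′ · b ≡ y · eliminatedRhs
    y′·b≡y·b″ = begin
      τ * b zero + y · tail b          ≡⟨ solve 4 (λ s i b₀ u → (:- (s :* i)) :* b₀ :+ u := u :- s :* (b₀ :* i)) refl σ (1/ α) (b zero) (y · tail b) ⟩
      y · tail b - σ * xⱼ              ≡⟨ ·-sub-*ʳ y (tail b) (tail (column A j)) xⱼ ⟨
      y · eliminatedRhs                ∎
      where open ≡-Reasoning

  PAdicSolution-eliminated : IsPAdic p xⱼ → PAdicSolution p eliminated eliminatedRhs → PAdicSolution p A b
  PAdicSolution-eliminated xⱼ-pAdic (x″ , x″-pAdic , A″x″≡b″) = x , x-pAdic , Ax≡b
    where
    x : Vecℚ n
    x = updateAt x″ j (const xⱼ)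
    x-pAdic : IsPAdicPoint p x
    x-pAdic = updateAt-All (IsPAdic p) x″ j x″-pAdic xⱼ-pAdic
    xₗ≡x″ₗ : ∀ {l} → l ≢ j → x l ≡ x″ l
    xₗ≡x″ₗ {l} = updateAt-minimal l j x″
    Ax≡b : ∀ i → row A i · x ≡ b i
    Ax≡b zero = begin
      row A zero · x
        ≡⟨ Σℚ-update (λ l → row A zero l * x l) (λ _ → 0ℚ) j (λ l l≢j → trans (cong (λ a → ℤ→ℚ a * x l) (others l l≢j)) (ℚP.*-zeroˡ (x l))) ⟩
      Σℚ {n} (λ _ → 0ℚ) + (α * x j - 0ℚ)
        ≡⟨ cong₂ (λ s z → s + (α * z - 0ℚ)) (Σℚ-zero n) (updateAt-updates j {const xⱼ} x″) ⟩
      0ℚ + (α * xⱼ - 0ℚ)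
        ≡⟨ solve 3 (λ a b i → con 0ℚ :+ (a :* (b :* i) :- con 0ℚ) := b :* (i :* a)) refl α (b zero) (1/ α) ⟩
      b zero * (1/ α * α)
        ≡⟨ cong (b zero *_) (ℚP.*-inverseˡ α) ⟩
      b zero * 1ℚ
        ≡⟨ ℚP.*-identityʳ (b zero) ⟩
      b zero                                  ∎
      where open ≡-Reasoning
    Ax≡b (suc i) = begin
      row A (suc i) · x
        ≡⟨ Σℚ-update _ _ j (λ l l≢j → cong₂ _*_ (cong ℤ→ℚ (sym (updateAt-minimal l j (A (suc i)) l≢j))) (xₗ≡x″ₗ l≢j)) ⟩
      row eliminated i · x″ + (c * x j - ℤ→ℚ (eliminated i j) * x″ j)
        ≡⟨ cong₂ (λ r a → r + (c * x j - ℤ→ℚ a * x″ j)) (A″x″≡b″ i) (updateAt-updates j (A (suc i))) ⟩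
      eliminatedRhs i + (c * x j - 0ℚ * x″ j)
        ≡⟨ cong (λ z → eliminatedRhs i + (c * z - 0ℚ * x″ j)) (updateAt-updates j x″) ⟩
      (b (suc i) - c * xⱼ) + (c * xⱼ - 0ℚ * x″ j)
        ≡⟨ solve 3 (λ b c y → (b :- c) :+ (c :- con 0ℚ :* y) := b) refl (b (suc i)) (c * xⱼ) (x″ j) ⟩
      b (suc i)                                                         ∎
      where
      open ≡-Reasoning
      c : ℚ
      c = column A j (suc i)

module _ {p : ℕ} .{{_ : ℕ.NonZero p}} where

  private
    farkasCondition⇒pAdicSolution-step : ∀ {m n} → (∀ (B : Matrix m n) c → FarkasCondition p B c → PAdicSolution p B c) →
                    ∀ (A : Matrix (suc m) n) b → Acc ℕ._<_ ‖ A zero ‖₁ → FarkasCondition p A b → PAdicSolution p A b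
    farkasCondition⇒pAdicSolution-step solveRest A b (acc smaller) cond with rowShape (A zero)
    ... | zeroRow A₀≡0 =
      PAdicSolution-zeroRow A b A₀≡0 (zeroRow⇒b₀≡0 A b A₀≡0 cond) (solveRest (tail A) (tail b) (FarkasCondition-tail A b cond))
    ... | pivotRow j Aⱼ≢0 others =
      PAdicSolution-eliminated (xⱼ-pAdic cond) (solveRest eliminated eliminatedRhs (FarkasCondition-eliminated cond))
      where open Pivot A b Aⱼ≢0 others
    ... | reducibleRow j k j≢k Aₖ≢0 ∣Aₖ∣≤∣Aⱼ∣ =
      PAdicSolution-addColumn p A b s j≢k
        (farkasCondition⇒pAdicSolution-step solveRest (addColumn A j k s) b (smaller decreasing) (FarkasCondition-addColumn p A b s j≢k cond))
      where
      instance _ = ℤ.≢-nonZero Aₖ≢0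
      s : ℤ
      s = ℤ.- (A zero j ℤ./ A zero k)
      decreasing : ‖ addColumn A j k s zero ‖₁ ℕ.< ‖ A zero ‖₁
      decreasing = ‖‖₁-updateAt-< (A zero) j (ℕP.<-≤-trans (∣u-[u/v]*v∣<∣v∣ (A zero j) (A zero k)) ∣Aₖ∣≤∣Aⱼ∣)

  farkasCondition⇒pAdicSolution : ∀ {m n} (A : Matrix m n) b → FarkasCondition p A b → PAdicSolution p A b
  farkasCondition⇒pAdicSolution {zero}  A b _    = (λ _ → 0ℚ) , (λ _ → IsPAdic-ℤ→ℚ p 0ℤ) , λ ()
  farkasCondition⇒pAdicSolution {suc m} A b cond = farkasCondition⇒pAdicSolution-step (farkasCondition⇒pAdicSolution {m}) A b (<-wellFounded _) cond

-- Polyhedra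

segment-bound : ∀ {a b d} → a ≤ d → (a ≡ d → b ≡ d) →
                ∃ λ N → ∀ t → 0ℚ ≤ t → t * ℕ→ℚ N ≤ 1ℚ → a + t * (b - a) ≤ d
segment-bound {a} {b} {d} a≤d tight with a ℚP.<? d
... | no a≮d = 0 , λ t _ _ → ℚP.≤-reflexive (begin-equality
  a + t * (b - a)   ≡⟨ cong₂ (λ a b → a + t * (b - a)) a≡d (tight a≡d) ⟩
  d + t * (d - d)   ≡⟨ solve 2 (λ d t → d :+ t :* (d :- d) := d) refl d t ⟩
  d                 ∎)
  where
  open ℚP.≤-Reasoning
  a≡d : a ≡ d
  a≡d = ℚP.≤-antisym a≤d (ℚP.≮⇒≥ a≮d)
... | yes a<d = N , bound
  where
  g : ℚ
  g = d - a
  instance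
    g>0 : ℚ.Positive g
    g>0 = ℚ.positive (subst (_< d - a) (ℚP.+-inverseʳ a) (ℚP.+-monoˡ-< (- a) a<d))
    _ = ℚP.pos⇒nonZero g
    _ = ℚP.pos⇒nonNeg g
  N : ℕ
  N = proj₁ (archimedean ((b - a) * 1/ g))
  b-a≤N*g : b - a ≤ ℕ→ℚ N * g
  b-a≤N*g = begin
    b - a                    ≡⟨ ℚP.*-identityʳ (b - a) ⟨
    (b - a) * 1ℚ             ≡⟨ cong ((b - a) *_) (ℚP.*-inverseˡ g) ⟨
    (b - a) * (1/ g * g)     ≡⟨ ℚP.*-assoc (b - a) (1/ g) g ⟨
    (b - a) * 1/ g * g       ≤⟨ ℚP.*-monoʳ-≤-nonNeg g (proj₂ (archimedean ((b - a) * 1/ g))) ⟩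
    ℕ→ℚ N * g                ∎
    where open ℚP.≤-Reasoning
  bound : ∀ t → 0ℚ ≤ t → t * ℕ→ℚ N ≤ 1ℚ → a + t * (b - a) ≤ d
  bound t 0≤t tN≤1 = begin
    a + t * (b - a)          ≤⟨ ℚP.+-monoʳ-≤ a (ℚP.*-monoˡ-≤-nonNeg t b-a≤N*g) ⟩
    a + t * (ℕ→ℚ N * g)      ≡⟨ cong (a +_) (sym (ℚP.*-assoc t (ℕ→ℚ N) g)) ⟩
    a + t * ℕ→ℚ N * g        ≤⟨ ℚP.+-monoʳ-≤ a (ℚP.*-monoʳ-≤-nonNeg g tN≤1) ⟩
    a + 1ℚ * g               ≡⟨ solve 2 (λ a d → a :+ con 1ℚ :* (d :- a) := d) refl a d ⟩
    d                        ∎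
    where
    open ℚP.≤-Reasoning
    instance _ = ℚ.nonNegative 0≤t

∃-upper-bound : ∀ {k} {Q : Fin k → ℕ → Set} → (∀ {i M N} → M ℕ.≤ N → Q i M → Q i N) →
                (∀ i → ∃ (Q i)) → ∃ λ N → ∀ i → Q i N
∃-upper-bound {zero}  mono bounds = 0 , λ ()
∃-upper-bound {suc k} mono bounds with bounds zero | ∃-upper-bound mono (bounds ∘ suc)
... | N₀ , Q₀N₀ | N , QN = N₀ ⊔ N , λ { zero → mono (ℕP.m≤m⊔n N₀ N) Q₀N₀ ; (suc i) → mono (ℕP.m≤n⊔m N₀ N) (QN i) }

module _ {n} (P : Polyhedron n) where
  open Polyhedron P

  segment-∈P : ∀ {c x} → c ∈P P → (∀ i → C i · c ≡ d i → C i · x ≡ d i) →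
               ∃ λ N → ∀ t → 0ℚ ≤ t → t * ℕ→ℚ N ≤ 1ℚ → (λ j → c j + t * (x j - c j)) ∈P P
  segment-∈P {c} {x} c∈P tight with ∃-upper-bound mono (λ i → segment-bound (c∈P i) (tight i))
    where
    mono : ∀ {i M N} → M ℕ.≤ N →
           (∀ t → 0ℚ ≤ t → t * ℕ→ℚ M ≤ 1ℚ → C i · c + t * (C i · x - C i · c) ≤ d i) →
           (∀ t → 0ℚ ≤ t → t * ℕ→ℚ N ≤ 1ℚ → C i · c + t * (C i · x - C i · c) ≤ d i)
    mono M≤N bound t 0≤t tN≤1 = bound t 0≤t (ℚP.≤-trans (ℚP.*-monoˡ-≤-nonNeg t (ℕ→ℚ-mono-≤ M≤N)) tN≤1)
      where instance _ = ℚ.nonNegative 0≤t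
  ... | N , bound = N , λ t 0≤t tN≤1 i → subst (_≤ d i) (sym (·-segment (C i) c x t)) (bound i t 0≤t tN≤1)

  -- The centroid of the points spanning x is tight only where all of them, and hence x, are.
  InAffineHull⇒inner-point : ∀ {x} → InAffineHull P x → ∃ λ c → c ∈P P × (∀ i → C i · c ≡ d i → C i · x ≡ d i)
  InAffineHull⇒inner-point (zero , _ , _ , _ , Σμ≡1 , _) = ⊥-elim (ℚP.1≢0 (sym Σμ≡1))
  InAffineHull⇒inner-point {x} (suc r , v , μ , v∈P , Σμ≡1 , μv≡x) = centroid v , c∈P , tight
    where
    C·c≡mean : ∀ i → C i · centroid v ≡ mean (λ k → C i · v k)
    C·c≡mean i = ·-combination (C i) (λ _ → 1/[1+ r ]) v
    c∈P : centroid v ∈P P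
    c∈P i = subst (_≤ d i) (sym (C·c≡mean i)) (mean-≤ (λ k → v∈P k i))
    tight : ∀ i → C i · centroid v ≡ d i → C i · x ≡ d i
    tight i C·c≡d = begin
      C i · x                            ≡⟨ Σℚ-cong (λ j → cong (C i j *_) (μv≡x j)) ⟨
      C i · (λ j → μ · (λ k → v k j))    ≡⟨ ·-combination (C i) μ v ⟩
      μ · (λ k → C i · v k)              ≡⟨ Σℚ-cong (λ k → cong (μ k *_) (mean-≡⇒≡ (λ k → v∈P k i) (trans (sym (C·c≡mean i)) C·c≡d) k)) ⟩
      μ · (λ _ → d i)                    ≡⟨ Σℚ-*ʳ μ (d i) ⟩
      Σℚ μ * d i                         ≡⟨ cong (_* d i) Σμ≡1 ⟩
      1ℚ * d i                           ≡⟨ ℚP.*-identityˡ (d i) ⟩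
      d i                                ∎
      where open ≡-Reasoning

∈P⇒InAffineHull : ∀ {n} {P : Polyhedron n} {x} → x ∈P P → InAffineHull P x
∈P⇒InAffineHull {x = x} x∈P = 1 , (λ _ → x) , (λ _ → 1ℚ) , (λ _ → x∈P) , ℚP.+-identityʳ 1ℚ ,
  λ j → trans (ℚP.+-identityʳ _) (ℚP.*-identityˡ (x j))

IsPAdic-clear-denominator : ∀ {p s w} e D q → s * ℕ→ℚ (p ^ e) ≡ ℕ→ℚ q * ℕ→ℚ D → IsIntegral (w * ℕ→ℚ D) → IsPAdic p (s * w)
IsPAdic-clear-denominator {p} {s} {w} e D q s*pᵉ≡q*D (a , w*D≡a) = a ℤ.* ℤ.+ q , e , (begin
  s * w * ℕ→ℚ (p ^ e)           ≡⟨ solve 3 (λ s w m → s :* w :* m := w :* (s :* m)) refl s w (ℕ→ℚ (p ^ e)) ⟩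
  w * (s * ℕ→ℚ (p ^ e))         ≡⟨ cong (w *_) s*pᵉ≡q*D ⟩
  w * (ℕ→ℚ q * ℕ→ℚ D)           ≡⟨ solve 3 (λ w q d → w :* (q :* d) := w :* d :* q) refl w (ℕ→ℚ q) (ℕ→ℚ D) ⟩
  w * ℕ→ℚ D * ℕ→ℚ q             ≡⟨ cong (_* ℕ→ℚ q) w*D≡a ⟩
  ℤ→ℚ a * ℕ→ℚ q                 ≡⟨ ℤ→ℚ-* a (ℤ.+ q) ⟨
  ℤ→ℚ (a ℤ.* ℤ.+ q)             ∎)
  where open ≡-Reasoning

module RemainderRatio (M D : ℕ) .{{_ : NonZero M}} .{{_ : NonZero D}} where

  private instance
    M>0 : ℚ.Positive (ℕ→ℚ M)
    M>0 = ℚP.normalize-pos M 1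
    M≢0 : ℚ.NonZero (ℕ→ℚ M)
    M≢0 = ℚP.pos⇒nonZero (ℕ→ℚ M)

  t : ℚ
  t = ℕ→ℚ (M % D) * 1/ ℕ→ℚ M

  0≤t : 0ℚ ≤ t
  0≤t = ℚP.nonNegative⁻¹ t {{ℚP.nonNeg*nonNeg⇒nonNeg (ℕ→ℚ (M % D)) {{ℚP.normalize-nonNeg (M % D) 1}}
                                                      (1/ ℕ→ℚ M) {{ℚP.pos⇒nonNeg (1/ ℕ→ℚ M) {{ℚP.1/pos⇒pos (ℕ→ℚ M)}}}}}}

  t*N≤1 : ∀ N → D ℕ.* N ℕ.≤ M → t * ℕ→ℚ N ≤ 1ℚ
  t*N≤1 N DN≤M = begin
    t * ℕ→ℚ N                             ≡⟨ solve 3 (λ r i n → r :* i :* n := (r :* n) :* i) refl (ℕ→ℚ (M % D)) (1/ ℕ→ℚ M) (ℕ→ℚ N) ⟩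
    ℕ→ℚ (M % D) * ℕ→ℚ N * 1/ ℕ→ℚ M       ≡⟨ cong (_* 1/ ℕ→ℚ M) (ℕ→ℚ-* (M % D) N) ⟨
    ℕ→ℚ (M % D ℕ.* N) * 1/ ℕ→ℚ M          ≤⟨ ℚP.*-monoʳ-≤-nonNeg (1/ ℕ→ℚ M) {{ℚP.pos⇒nonNeg (1/ ℕ→ℚ M) {{ℚP.1/pos⇒pos (ℕ→ℚ M)}}}} (ℕ→ℚ-mono-≤ rN≤M) ⟩
    ℕ→ℚ M * 1/ ℕ→ℚ M                      ≡⟨ ℚP.*-inverseʳ (ℕ→ℚ M) ⟩
    1ℚ                                    ∎
    where
    open ℚP.≤-Reasoning
    rN≤M : M % D ℕ.* N ℕ.≤ M
    rN≤M = ℕP.≤-trans (ℕP.*-monoˡ-≤ N (ℕP.<⇒≤ (m%n<n M D))) DN≤M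

  [1-t]*M≡[M/D]*D : (1ℚ - t) * ℕ→ℚ M ≡ ℕ→ℚ (M / D) * ℕ→ℚ D
  [1-t]*M≡[M/D]*D = begin
    (1ℚ - t) * ℕ→ℚ M
      ≡⟨ solve 3 (λ r i m → (con 1ℚ :- r :* i) :* m := m :- r :* (i :* m)) refl (ℕ→ℚ (M % D)) (1/ ℕ→ℚ M) (ℕ→ℚ M) ⟩
    ℕ→ℚ M - ℕ→ℚ (M % D) * (1/ ℕ→ℚ M * ℕ→ℚ M)
      ≡⟨ cong₂ (λ m z → m - ℕ→ℚ (M % D) * z) (cong ℕ→ℚ (m≡m%n+[m/n]*n M D)) (ℚP.*-inverseˡ (ℕ→ℚ M)) ⟩
    ℕ→ℚ (M % D ℕ.+ M / D ℕ.* D) - ℕ→ℚ (M % D) * 1ℚ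
      ≡⟨ cong (_- ℕ→ℚ (M % D) * 1ℚ) (trans (ℕ→ℚ-+ (M % D) _) (cong (ℕ→ℚ (M % D) +_) (ℕ→ℚ-* (M / D) D))) ⟩
    ℕ→ℚ (M % D) + ℕ→ℚ (M / D) * ℕ→ℚ D - ℕ→ℚ (M % D) * 1ℚ
      ≡⟨ solve 2 (λ r s → r :+ s :- r :* con 1ℚ := s) refl (ℕ→ℚ (M % D)) (ℕ→ℚ (M / D) * ℕ→ℚ D) ⟩
    ℕ→ℚ (M / D) * ℕ→ℚ D                                    ∎
    where open ≡-Reasoning

-- With M = p^(D N) and D a common denominator of c − x, the step t = (M mod D)/M is at most
-- 1/N while 1 − t = (M div D) D / M clears the denominators of c − x up to a power of p.
pAdic-point-on-segment : ∀ {p n} → 1 ℕ.< p → {x : Vecℚ n} → IsPAdicPoint p x → ∀ (c : Vecℚ n) N →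
                         ∃ λ t → 0ℚ ≤ t × t * ℕ→ℚ N ≤ 1ℚ × IsPAdicPoint p (λ j → c j + t * (x j - c j))
pAdic-point-on-segment {p} 1<p {x} x-pAdic c N with common-denominator (λ j → c j - x j)
... | D , D≢0 , integral = t , 0≤t , t*N≤1 N (ℕP.<⇒≤ (n<p^n 1<p (D ℕ.* N))) , pAdic
  where
  instance
    _ = D≢0
    _ = ℕP.m^n≢0 p (D ℕ.* N) {{ℕ.>-nonZero (ℕP.<-trans (ℕP.n<1+n 0) 1<p)}}
  open RemainderRatio (p ^ (D ℕ.* N)) D
  pAdic : IsPAdicPoint p (λ j → c j + t * (x j - c j))
  pAdic j = subst (IsPAdic p) (solve 3 (λ x c t → x :+ (con 1ℚ :- t) :* (c :- x) := c :+ t :* (x :- c)) refl (x j) (c j) t)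
    (IsPAdic-+ p {x j} (x-pAdic j)
      (IsPAdic-clear-denominator {s = 1ℚ - t} {c j - x j} (D ℕ.* N) D (p ^ (D ℕ.* N) / D) [1-t]*M≡[M/D]*D (integral j)))

corollary2p6 : {n m : ℕ} (P : Polyhedron n) (A : Fin m → Fin n → ℤ) (b : Fin m → ℤ) →
    Nonempty P → AffineHullIs P A b →
    (p : ℕ) → Prime p →
    ((∃ λ (x : Vecℚ n) → x ∈P P × IsPAdicPoint p x) ⇔
     (¬ (∃ λ (y : Fin m → ℚ) →
          (∀ j → IsIntegral (Σℚ (λ i → y i * ℤ→ℚ (A i j)))) ×
          ¬ IsPAdic p (Σℚ (λ i → y i * ℤ→ℚ (b i))))))
corollary2p6 P A b _ hull p p-prime = mk⇔ necessary sufficient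
  where
  b′ : Vecℚ _
  b′ i = ℤ→ℚ (b i)
  PAdicPointInP NoCertificate : Set
  PAdicPointInP = ∃ λ x → x ∈P P × IsPAdicPoint p x
  NoCertificate = ¬ (∃ λ y → (∀ j → IsIntegral (y · column A j)) × ¬ IsPAdic p (y · b′))
  necessary : PAdicPointInP → NoCertificate
  necessary (x , x∈P , x-pAdic) (y , y·A-integral , y·b-not-pAdic) = y·b-not-pAdic
    (pAdicSolution⇒farkasCondition p {A = A} {b′} (x , x-pAdic , proj₁ (hull x) (∈P⇒InAffineHull {P = P} x∈P)) y y·A-integral)
  sufficient : NoCertificate → PAdicPointInP
  sufficient no-certificate =
    let x₀ , x₀-pAdic , Ax₀≡b = farkasCondition⇒pAdicSolution {{prime⇒nonZero p-prime}} A b′ cond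
        c , c∈P , tight       = InAffineHull⇒inner-point P (proj₂ (hull x₀) Ax₀≡b)
        N , segment           = segment-∈P P c∈P tight
        t , 0≤t , tN≤1 , pAdic = pAdic-point-on-segment (ℕ.nonTrivial⇒n>1 p {{prime⇒nonTrivial p-prime}}) {x₀} x₀-pAdic c N
    in _ , segment t 0≤t tN≤1 , pAdic
    where
    cond : FarkasCondition p A b′
    cond y y·A-integral = decidable-stable (IsPAdic? p-prime (y · b′)) λ not-pAdic → no-certificate (y , y·A-integral , not-pAdic)
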